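{- For all $n\in\mathbb N$ (with $n\ge1$), $$\zeta^f((x_0x_1)^nx_0)=-2\sum_{i=0}^{n-1}\zeta^f(\{2\}^i,3,\{2\}^{n-1-i})=2\sum_{i=1}^n(-1)^i\zeta^f(2i+1)\,\zeta^f(\{2\}^{n-i}).$$
   Context: Let $X=\{x_0,x_1\}$ and let $\mathbb Q\langle X\rangle$ be the free non-commutative $\mathbb Q$-algebra on $X$ (words, empty word $\mathbf 1$). Shuffle product: $\mathbf 1\sqcup\!\sqcup w=w\sqcup\!\sqcup\mathbf 1=w$ and $au\sqcup\!\sqcup bv=a(u\sqcup\!\sqcup bv)+b(au\sqcup\!\sqcup v)$. Stuffle product on $\mathbb Q\langle Y\rangle$, $Y=\{y_1,y_2,\dots\}$: $\mathbf 1*w=w*\mathbf 1=w$ and $y_iu*y_jv=y_i(u*y_jv)+y_j(y_iu*v)+y_{i+j}(u*v)$. Let $\iota(y_{k_1}\cdots y_{k_d})=x_0^{k_1-1}x_1\cdots x_0^{k_d-1}x_1$, $\mathfrak h^0=\mathbb Q\mathbf 1+x_0\mathbb Q\langle X\rangle x_1$ and $\mathfrak h^1=\mathbb Q\mathbf 1+\mathbb Q\langle X\rangle x_1$. $\mathcal Z^f=(\mathbb Q\langle X\rangle,\sqcup\!\sqcup)/R$, with $R$ the ideal generated by $x_0$, $x_1$ and all $u\sqcup\!\sqcup v-\iota(\iota^{ -1}(u)*\iota^{ -1}(v))$ ($u\in\mathfrak h^0$, $v\in\mathfrak h^1$). $\zeta^f:\mathbb Q\langle X\rangle\to\mathcal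 Z^f$ is the projection, and $\zeta^f(k_1,\dots,k_d)=\zeta^f(x_0^{k_1-1}x_1\cdots x_0^{k_d-1}x_1)$. Here $\{2\}^i$ denotes $i$ repetitions of $2$, and $\zeta^f(\{2\}^0)=1$. -}

module Defs where

open import Data.Nat using (ℕ; zero; suc; _∸_) renaming (_+_ to _+ℕ_)
open import Data.Rational using (ℚ; 0ℚ; 1ℚ; _+_; _*_; -_)
open import Data.List using (List; []; _∷_; _++_; map; concatMap; replicate; upTo; concat)
open import Data.List.Properties using (≡-dec)
open import Data.Product using (_×_; _,_)
open import Data.Unit using (⊤)
open import Data.Empty using (⊥)
open import Relation.Binary.PropositionalEquality using (_≡_; refl)
open import Relation.Nullary using (Dec; yes; no)

data Letter : Set where
  x₀ x₁ : Letter

_≟L_ : (a b : Letter) → Dec (a ≡ b)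
x₀ ≟L x₀ = yes refl
x₀ ≟L x₁ = no (λ ())
x₁ ≟L x₀ = no (λ ())
x₁ ≟L x₁ = yes refl

Word : Set
Word = List Letter

-- Finite Q-linear combinations of words over an alphabet A
-- (a list of (coefficient , word) pairs; the represented element is the sum).
LC : Set → Set
LC A = List (ℚ × List A)

Poly : Set
Poly = LC Letter

⟦_⟧ : Word → Poly
⟦ w ⟧ = (1ℚ , w) ∷ []

prefix : {A : Set} → A → LC A → LC A
prefix a = map (λ { (c , w) → (c , a ∷ w) })

scale : {A : Set} → ℚ → LC A → LC A
scale d = map (λ { (c , w) → (d * c , w) })

_⊕_ : {A : Set} → LC A → LC A → LC A
p ⊕ q = p ++ q

_⊖_ : {A : Set} → LC A → LC A → LC A
p ⊖ q = p ++ scale (- 1ℚ) q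

shw : Word → Word → Poly
shw [] v = (1ℚ , v) ∷ []
shw (a ∷ u) [] = (1ℚ , a ∷ u) ∷ []
shw (a ∷ u) (b ∷ v) = prefix a (shw u (b ∷ v)) ++ prefix b (shw (a ∷ u) v)

_ш_ : Poly → Poly → Poly
p ш q = concatMap (λ { (c , u) → concatMap (λ { (d , v) → scale (c * d) (shw u v) }) q }) p

-- Words over Y = {y₁, y₂, ...}: the natural number k encodes the letter y_(k+1).
YWord : Set
YWord = List ℕ

-- Stuffle product of Y-words:  y_i u * y_j v = y_i(u * y_j v) + y_j(y_i u * v) + y_(i+j)(u * v)
-- (with the encoding, y_(i+j) for codes a = i-1, b = j-1 has code suc (a + b)).
stw : YWord → YWord → LC ℕ
stw [] v = (1ℚ , v) ∷ []
stw (a ∷ u) [] = (1ℚ , a ∷ u) ∷ []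
stw (a ∷ u) (b ∷ v) =
  prefix a (stw u (b ∷ v)) ++ prefix b (stw (a ∷ u) v) ++ prefix (suc (a +ℕ b)) (stw u v)

-- ι(y_{k₁} ⋯ y_{k_d}) = x₀^{k₁-1} x₁ ⋯ x₀^{k_d-1} x₁
ιw : YWord → Word
ιw [] = []
ιw (k ∷ u) = replicate k x₀ ++ (x₁ ∷ ιw u)

ιP : LC ℕ → Poly
ιP = map (λ { (c , w) → (c , ιw w) })

-- ι(u) ∈ 𝔥⁰ : u empty or its first letter is y_k with k ≥ 2
InH0 : YWord → Set
InH0 [] = ⊤
InH0 (zero ∷ _) = ⊥
InH0 (suc _ ∷ _) = ⊤

coeff : Poly → Word → ℚ
coeff [] w = 0ℚ
coeff ((c , u) ∷ p) w with ≡-dec _≟L_ u w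
... | yes _ = c + coeff p w
... | no _ = coeff p w

_≈_ : Poly → Poly → Set
p ≈ q = ∀ w → coeff p w ≡ coeff q w

-- The ideal R of (Q⟨X⟩, ш) generated by x₀, x₁ and the double shuffle relations
-- u ш v − ι(ι⁻¹u * ι⁻¹v), u ∈ 𝔥⁰, v ∈ 𝔥¹ (by linearity it suffices to take words).
data InR : Poly → Set where
  gen-x₀ : InR ⟦ x₀ ∷ [] ⟧
  gen-x₁ : InR ⟦ x₁ ∷ [] ⟧
  gen-ds : (u v : YWord) → InH0 u → InR (shw (ιw u) (ιw v) ⊖ ιP (stw u v))
  zero-R : InR []
  add-R  : {p q : Poly} → InR p → InR q → InR (p ⊕ q)
  mul-R  : {p : Poly} → (r : Poly) → InR p → InR (r ш p)
  resp-R : {p q : Poly} → p ≈ q → InR p → InR q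

-- equality in 𝒵^f = (Q⟨X⟩, ш)/R : ζ^f(p) = ζ^f(q)
_≡ᶠ_ : Poly → Poly → Set
p ≡ᶠ q = InR (p ⊖ q)

-- the word x₀^{k₁-1}x₁ ⋯ x₀^{k_d-1}x₁, so ζ^f(k₁,…,k_d) = ζ^f(⟦ zw (k₁ ∷ … ∷ k_d ∷ []) ⟧)
zw : List ℕ → Word
zw ks = ιw (map (λ k → k ∸ 1) ks)

Σ : List ℕ → (ℕ → Poly) → Poly
Σ is f = concatMap f is

sgn : ℕ → ℚ
sgn zero = 1ℚ
sgn (suc i) = - sgn i

two : ℚ
two = 1ℚ + 1ℚ

module Submission where

-- Since x₀ ∈ R, the shuffle (x₀x₁)ⁿ ш x₀ vanishes in 𝒵^f. Inserting x₀ into (x₀x₁)ⁿ either at the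
-- end or on either side of one of the n letters x₀ gives (x₀x₁)ⁿx₀ + 2 Σᵢ ζ({2}^i,3,{2}^(n-1-i)),
-- which is the first equality.
-- For the second, add up the double shuffle relations ζ(2i+1) ш ζ({2}^(n-i)) = ζ(2i+1) * ζ({2}^(n-i))
-- with signs (-1)^i, 1 ≤ i ≤ n. The stuffle y_(2i+1) * y₂^(n-i) consists of the words in which
-- y_(2i+1) is inserted among the y₂'s, and of those in which it is merged with one y₂ into y_(2i+3);
-- the latter are the former for i+1, so the alternating sum of the stuffles telescopes to
-- -Σᵢ ζ({2}^i,3,{2}^(n-1-i)).

open import Defs
open import Data.Nat using (ℕ; suc; _∸_; _≤_; _*_; _+_)
open import Data.Rational using (-_)
open import Data.List using (List; []; _∷_; _++_; map; replicate; upTo; concat)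
open import Data.Product using (_×_)

open import Data.Nat using (zero; _<_)
open import Data.Nat.Properties using (m+n∸n≡m; n∸n≡0; +-∸-assoc; +-comm; *-suc)
open import Data.Rational using (ℚ; 0ℚ; 1ℚ) renaming (_+_ to _+ℚ_; _*_ to _*ℚ_)
open import Data.Rational.Properties using (*-identityʳ; *-zeroʳ; +-identityˡ; +-assoc; *-distribˡ-+)
import Data.Rational.Properties as ℚ
open import Data.Rational.Solver using (module +-*-Solver)
open import Data.List using (applyUpTo)
open import Data.List.Properties
  using ( ≡-dec; ∷-injectiveˡ; ∷-injectiveʳ; ++-identityʳ; ++-assoc; map-++; map-replicate
        ; concatMap-++; concatMap-map; map-concatMap; upTo-∷ʳ; map-upTo)
open import Data.List.Relation.Unary.All using (All; []; _∷_; universal)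
open import Data.List.Relation.Unary.All.Properties using (applyUpTo⁺₁)
open import Data.Product using (_,_)
open import Data.Unit using (tt)
open import Function using (_∘_; id)
open import Relation.Binary.Bundles using (Setoid)
open import Relation.Binary.PropositionalEquality
open import Relation.Nullary using (Dec; yes; no; ¬_; contradiction)
import Relation.Binary.Reasoning.Setoid as SetoidReasoning

open +-*-Solver using (solve; _:+_; _:*_; :-_; _:=_; con)

coeff-∷-≡ : ∀ c p {u w} → u ≡ w → coeff ((c , u) ∷ p) w ≡ c +ℚ coeff p w
coeff-∷-≡ c p {u} {w} u≡w with ≡-dec _≟L_ u w
... | yes _ = refl
... | no u≢w = contradiction u≡w u≢w

coeff-∷-≢ : ∀ c p {u w} → ¬ u ≡ w → coeff ((c , u) ∷ p) w ≡ coeff p w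
coeff-∷-≢ c p {u} {w} u≢w with ≡-dec _≟L_ u w
... | yes u≡w = contradiction u≡w u≢w
... | no _ = refl

coeff-++ : ∀ p q w → coeff (p ++ q) w ≡ coeff p w +ℚ coeff q w
coeff-++ [] q w = sym (+-identityˡ _)
coeff-++ ((c , u) ∷ p) q w with ≡-dec _≟L_ u w
... | yes _ = trans (cong (c +ℚ_) (coeff-++ p q w)) (sym (+-assoc c _ _))
... | no _ = coeff-++ p q w

coeff-scale : ∀ c p w → coeff (scale c p) w ≡ c *ℚ coeff p w
coeff-scale c [] w = sym (*-zeroʳ c)
coeff-scale c ((d , u) ∷ p) w with ≡-dec _≟L_ u w
... | yes _ = trans (cong (c *ℚ d +ℚ_) (coeff-scale c p w)) (sym (*-distribˡ-+ c d _))
... | no _ = coeff-scale c p w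

coeff-⊖ : ∀ p q w → coeff (p ⊖ q) w ≡ coeff p w +ℚ - 1ℚ *ℚ coeff q w
coeff-⊖ p q w = trans (coeff-++ p (scale (- 1ℚ) q) w) (cong (coeff p w +ℚ_) (coeff-scale (- 1ℚ) q w))

coeff-prefix-∷ : ∀ a p w → coeff (prefix a p) (a ∷ w) ≡ coeff p w
coeff-prefix-∷ a [] w = refl
coeff-prefix-∷ a ((c , u) ∷ p) w = by-cases (≡-dec _≟L_ u w)
  where
  open ≡-Reasoning
  by-cases : Dec (u ≡ w) → coeff (prefix a ((c , u) ∷ p)) (a ∷ w) ≡ coeff ((c , u) ∷ p) w
  by-cases (yes u≡w) = begin
    coeff (prefix a ((c , u) ∷ p)) (a ∷ w)  ≡⟨ coeff-∷-≡ c (prefix a p) (cong (a ∷_) u≡w) ⟩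
    c +ℚ coeff (prefix a p) (a ∷ w)          ≡⟨ cong (c +ℚ_) (coeff-prefix-∷ a p w) ⟩
    c +ℚ coeff p w                           ≡⟨ coeff-∷-≡ c p u≡w ⟨
    coeff ((c , u) ∷ p) w                    ∎
  by-cases (no u≢w) = begin
    coeff (prefix a ((c , u) ∷ p)) (a ∷ w)  ≡⟨ coeff-∷-≢ c (prefix a p) {a ∷ u} (λ au≡aw → u≢w (∷-injectiveʳ au≡aw)) ⟩
    coeff (prefix a p) (a ∷ w)               ≡⟨ coeff-prefix-∷ a p w ⟩
    coeff p w                                ≡⟨ coeff-∷-≢ c p u≢w ⟨
    coeff ((c , u) ∷ p) w                    ∎

coeff-prefix-∉ : ∀ a p w → (∀ v → ¬ a ∷ v ≡ w) → coeff (prefix a p) w ≡ 0ℚ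
coeff-prefix-∉ a [] w a∉w = refl
coeff-prefix-∉ a ((c , u) ∷ p) w a∉w =
  trans (coeff-∷-≢ c (prefix a p) (a∉w u)) (coeff-prefix-∉ a p w a∉w)

-- A record around _≈_, so that the polynomials it relates can be inferred.
infix 4 _≋_
record _≋_ (p q : Poly) : Set where
  constructor coeffwise
  field ≋⇒≈ : p ≈ q
open _≋_ public

≋-setoid : Setoid _ _
≋-setoid = record
  { Carrier = Poly
  ; _≈_ = _≋_
  ; isEquivalence = record
    { refl = coeffwise λ _ → refl
    ; sym = λ p≋q → coeffwise λ w → sym (≋⇒≈ p≋q w)
    ; trans = λ p≋q q≋r → coeffwise λ w → trans (≋⇒≈ p≋q w) (≋⇒≈ q≋r w)
    }
  }

open Setoid ≋-setoid public using () renaming (refl to ≋-refl; sym to ≋-sym; reflexive to ≋-reflexive)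
module ≋-Reasoning = SetoidReasoning ≋-setoid

++-cong : ∀ {p p′ q q′} → p ≋ p′ → q ≋ q′ → p ++ q ≋ p′ ++ q′
++-cong {p} {p′} {q} {q′} p≋p′ q≋q′ = coeffwise λ w → begin
  coeff (p ++ q) w          ≡⟨ coeff-++ p q w ⟩
  coeff p w +ℚ coeff q w    ≡⟨ cong₂ _+ℚ_ (≋⇒≈ p≋p′ w) (≋⇒≈ q≋q′ w) ⟩
  coeff p′ w +ℚ coeff q′ w  ≡⟨ coeff-++ p′ q′ w ⟨
  coeff (p′ ++ q′) w        ∎
  where open ≡-Reasoning

++-congˡ : ∀ p {q q′} → q ≋ q′ → p ++ q ≋ p ++ q′
++-congˡ p = ++-cong (≋-refl {p})

∷-cong : ∀ t {p q} → p ≋ q → t ∷ p ≋ t ∷ q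
∷-cong t = ++-congˡ (t ∷ [])

scale-cong : ∀ c {p q} → p ≋ q → scale c p ≋ scale c q
scale-cong c {p} {q} p≋q = coeffwise λ w →
  trans (coeff-scale c p w) (trans (cong (c *ℚ_) (≋⇒≈ p≋q w)) (sym (coeff-scale c q w)))

⊖-cong : ∀ {p p′ q q′} → p ≋ p′ → q ≋ q′ → p ⊖ q ≋ p′ ⊖ q′
⊖-cong p≋p′ q≋q′ = ++-cong p≋p′ (scale-cong (- 1ℚ) q≋q′)

prefix-cong : ∀ a {p q} → p ≋ q → prefix a p ≋ prefix a q
prefix-cong a {p} {q} p≋q = coeffwise at
  where
  at : prefix a p ≈ prefix a q
  at [] = trans (coeff-prefix-∉ a p [] λ _ ()) (sym (coeff-prefix-∉ a q [] λ _ ()))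
  at (b ∷ w) with a ≟L b
  ... | yes refl = trans (coeff-prefix-∷ a p w) (trans (≋⇒≈ p≋q w) (sym (coeff-prefix-∷ a q w)))
  ... | no a≢b = trans (coeff-prefix-∉ a p (b ∷ w) a∉) (sym (coeff-prefix-∉ a q (b ∷ w) a∉))
    where
    a∉ : ∀ v → ¬ a ∷ v ≡ b ∷ w
    a∉ v av≡bw = a≢b (∷-injectiveˡ av≡bw)

++-comm : ∀ p q → p ++ q ≋ q ++ p
++-comm p q = coeffwise λ w → begin
  coeff (p ++ q) w        ≡⟨ coeff-++ p q w ⟩
  coeff p w +ℚ coeff q w  ≡⟨ ℚ.+-comm (coeff p w) (coeff q w) ⟩
  coeff q w +ℚ coeff p w  ≡⟨ coeff-++ q p w ⟨
  coeff (q ++ p) w        ∎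
  where open ≡-Reasoning

++-scale≋⊖-scale : ∀ c p q → p ++ scale c q ≋ p ⊖ scale (- c) q
++-scale≋⊖-scale c p q = coeffwise λ w → begin
  coeff (p ++ scale c q) w                        ≡⟨ coeff-++ p (scale c q) w ⟩
  coeff p w +ℚ coeff (scale c q) w                ≡⟨ cong (coeff p w +ℚ_) (coeff-scale c q w) ⟩
  coeff p w +ℚ c *ℚ coeff q w                     ≡⟨ solve 3 (λ a c b → a :+ c :* b := a :+ con (- 1ℚ) :* (:- c :* b))
                                                           refl (coeff p w) c (coeff q w) ⟩
  coeff p w +ℚ - 1ℚ *ℚ (- c *ℚ coeff q w)         ≡⟨ cong (λ x → coeff p w +ℚ - 1ℚ *ℚ x) (coeff-scale (- c) q w) ⟨
  coeff p w +ℚ - 1ℚ *ℚ coeff (scale (- c) q) w    ≡⟨ coeff-⊖ p (scale (- c) q) w ⟨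
  coeff (p ⊖ scale (- c) q) w                     ∎
  where open ≡-Reasoning

prefix-++ : ∀ {A : Set} (a : A) (p q : LC A) → prefix a (p ++ q) ≡ prefix a p ++ prefix a q
prefix-++ a p q = map-++ _ p q

prefix-scale : ∀ (a : Letter) c p → prefix a (scale c p) ≡ scale c (prefix a p)
prefix-scale a c [] = refl
prefix-scale a c ((d , u) ∷ p) = cong ((c *ℚ d , a ∷ u) ∷_) (prefix-scale a c p)

Σ-cong : ∀ {f g : ℕ → Poly} {L} → All (λ i → f i ≋ g i) L → Σ L f ≋ Σ L g
Σ-cong [] = ≋-refl
Σ-cong (fi≋gi ∷ f≋g) = ++-cong fi≋gi (Σ-cong f≋g)

Σ-scale-⊖ : ∀ (s : ℕ → ℚ) (f g : ℕ → Poly) L →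
  Σ L (λ i → scale (s i) (f i ⊖ g i)) ≋ Σ L (λ i → scale (s i) (f i)) ⊖ Σ L (λ i → scale (s i) (g i))
Σ-scale-⊖ s f g [] = ≋-refl
Σ-scale-⊖ s f g (i ∷ L) = coeffwise λ w → begin
  coeff (scale (s i) (f i ⊖ g i) ++ Σ L (λ i → scale (s i) (f i ⊖ g i))) w
    ≡⟨ coeff-++ (scale (s i) (f i ⊖ g i)) _ w ⟩
  coeff (scale (s i) (f i ⊖ g i)) w +ℚ coeff (Σ L (λ i → scale (s i) (f i ⊖ g i))) w
    ≡⟨ cong₂ _+ℚ_ (trans (coeff-scale (s i) (f i ⊖ g i) w) (cong (s i *ℚ_) (coeff-⊖ (f i) (g i) w)))
                  (trans (≋⇒≈ (Σ-scale-⊖ s f g L) w) (coeff-⊖ F G w)) ⟩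
  s i *ℚ (coeff (f i) w +ℚ - 1ℚ *ℚ coeff (g i) w) +ℚ (coeff F w +ℚ - 1ℚ *ℚ coeff G w)
    ≡⟨ solve 5 (λ s φ γ Φ Γ → s :* (φ :+ con (- 1ℚ) :* γ) :+ (Φ :+ con (- 1ℚ) :* Γ)
                           := (s :* φ :+ Φ) :+ con (- 1ℚ) :* (s :* γ :+ Γ))
             refl (s i) (coeff (f i) w) (coeff (g i) w) (coeff F w) (coeff G w) ⟩
  (s i *ℚ coeff (f i) w +ℚ coeff F w) +ℚ - 1ℚ *ℚ (s i *ℚ coeff (g i) w +ℚ coeff G w)
    ≡⟨ cong₂ (λ x y → x +ℚ - 1ℚ *ℚ y) (sym (coeff-scale-++ (f i) F w)) (sym (coeff-scale-++ (g i) G w)) ⟩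
  coeff (scale (s i) (f i) ++ F) w +ℚ - 1ℚ *ℚ coeff (scale (s i) (g i) ++ G) w
    ≡⟨ coeff-⊖ (scale (s i) (f i) ++ F) (scale (s i) (g i) ++ G) w ⟨
  coeff ((scale (s i) (f i) ++ F) ⊖ (scale (s i) (g i) ++ G)) w ∎
  where
  open ≡-Reasoning
  F = Σ L (λ i → scale (s i) (f i))
  G = Σ L (λ i → scale (s i) (g i))
  coeff-scale-++ : ∀ h H w → coeff (scale (s i) h ++ H) w ≡ s i *ℚ coeff h w +ℚ coeff H w
  coeff-scale-++ h H w = trans (coeff-++ (scale (s i) h) H w) (cong (_+ℚ coeff H w) (coeff-scale (s i) h w))

alternating-telescope : ∀ (c : ℕ → Poly) n →
  Σ (upTo n) (λ j → scale (sgn (suc j)) (c j ++ c (suc j))) ≋ scale (sgn n) (c n) ⊖ c 0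
alternating-telescope c zero = coeffwise λ w → begin
  0ℚ                                          ≡⟨ solve 1 (λ x → con 0ℚ := con 1ℚ :* x :+ con (- 1ℚ) :* x) refl (coeff (c 0) w) ⟩
  1ℚ *ℚ coeff (c 0) w +ℚ - 1ℚ *ℚ coeff (c 0) w  ≡⟨ cong (_+ℚ - 1ℚ *ℚ coeff (c 0) w) (coeff-scale 1ℚ (c 0) w) ⟨
  coeff (scale 1ℚ (c 0)) w +ℚ - 1ℚ *ℚ coeff (c 0) w ≡⟨ coeff-⊖ (scale 1ℚ (c 0)) (c 0) w ⟨
  coeff (scale 1ℚ (c 0) ⊖ c 0) w              ∎
  where open ≡-Reasoning
alternating-telescope c (suc n) = coeffwise λ w → begin
  coeff (Σ (upTo (suc n)) f) w
    ≡⟨ cong (λ p → coeff p w) (trans (cong (λ L → Σ L f) (sym (upTo-∷ʳ n))) (concatMap-++ f (upTo n) (n ∷ []))) ⟩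
  coeff (Σ (upTo n) f ++ (f n ++ [])) w
    ≡⟨ trans (coeff-++ (Σ (upTo n) f) (f n ++ []) w)
             (cong₂ _+ℚ_ (trans (≋⇒≈ (alternating-telescope c n) w) (coeff-⊖ (scale (sgn n) (c n)) (c 0) w))
                         (trans (coeff-++ (f n) [] w) (cong (_+ℚ 0ℚ) (coeff-scale (sgn (suc n)) (c n ++ c (suc n)) w)))) ⟩
  (coeff (scale (sgn n) (c n)) w +ℚ - 1ℚ *ℚ coeff (c 0) w) +ℚ (- sgn n *ℚ coeff (c n ++ c (suc n)) w +ℚ 0ℚ)
    ≡⟨ cong₂ (λ x y → (x +ℚ - 1ℚ *ℚ coeff (c 0) w) +ℚ (- sgn n *ℚ y +ℚ 0ℚ))
             (coeff-scale (sgn n) (c n) w) (coeff-++ (c n) (c (suc n)) w) ⟩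
  (sgn n *ℚ coeff (c n) w +ℚ - 1ℚ *ℚ coeff (c 0) w) +ℚ (- sgn n *ℚ (coeff (c n) w +ℚ coeff (c (suc n)) w) +ℚ 0ℚ)
    ≡⟨ solve 4 (λ s a b d → (s :* b :+ con (- 1ℚ) :* a) :+ ((:- s) :* (b :+ d) :+ con 0ℚ)
                          := (:- s) :* d :+ con (- 1ℚ) :* a)
             refl (sgn n) (coeff (c 0) w) (coeff (c n) w) (coeff (c (suc n)) w) ⟩
  - sgn n *ℚ coeff (c (suc n)) w +ℚ - 1ℚ *ℚ coeff (c 0) w
    ≡⟨ trans (coeff-⊖ (scale (sgn (suc n)) (c (suc n))) (c 0) w)
             (cong (_+ℚ - 1ℚ *ℚ coeff (c 0) w) (coeff-scale (sgn (suc n)) (c (suc n)) w)) ⟨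
  coeff (scale (sgn (suc n)) (c (suc n)) ⊖ c 0) w ∎
  where
  open ≡-Reasoning
  f : ℕ → Poly
  f j = scale (sgn (suc j)) (c j ++ c (suc j))

≋-R : ∀ {p q} → p ≋ q → InR p → InR q
≋-R p≋q = resp-R (≋⇒≈ p≋q)

const-ш : ∀ c p → ((c , []) ∷ []) ш p ≡ scale c p
const-ш c [] = refl
const-ш c ((d , v) ∷ p) = cong₂ (λ e q → (e , v) ∷ q) (*-identityʳ (c *ℚ d)) (const-ш c p)

scale-R : ∀ c {p} → InR p → InR (scale c p)
scale-R c {p} p∈R = ≋-R (≋-reflexive (const-ш c p)) (mul-R ((c , []) ∷ []) p∈R)

Σ-R : ∀ {f : ℕ → Poly} → (∀ i → InR (f i)) → ∀ L → InR (Σ L f)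
Σ-R f∈R [] = zero-R
Σ-R f∈R (i ∷ L) = add-R (f∈R i) (Σ-R f∈R L)

⟦⟧-ш-⟦⟧ : ∀ u v → ⟦ u ⟧ ш ⟦ v ⟧ ≋ shw u v
⟦⟧-ш-⟦⟧ u v = coeffwise λ w → begin
  coeff ((scale (1ℚ *ℚ 1ℚ) (shw u v) ++ []) ++ []) w
    ≡⟨ cong (λ p → coeff p w) (trans (++-identityʳ (scale (1ℚ *ℚ 1ℚ) (shw u v) ++ [])) (++-identityʳ (scale (1ℚ *ℚ 1ℚ) (shw u v)))) ⟩
  coeff (scale (1ℚ *ℚ 1ℚ) (shw u v)) w  ≡⟨ coeff-scale (1ℚ *ℚ 1ℚ) (shw u v) w ⟩
  1ℚ *ℚ 1ℚ *ℚ coeff (shw u v) w         ≡⟨ solve 1 (λ x → con 1ℚ :* con 1ℚ :* x := x) refl (coeff (shw u v) w) ⟩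
  coeff (shw u v) w                      ∎
  where open ≡-Reasoning

-- The shuffle (x₀x₁)ⁿ ш x₀

x₀x₁^_ : ℕ → Word
x₀x₁^ m = concat (replicate m (x₀ ∷ x₁ ∷ []))

x₀x₁·_ : Poly → Poly
x₀x₁· p = prefix x₀ (prefix x₁ p)

x₀x₁·-cong : ∀ {p q} → p ≋ q → x₀x₁· p ≋ x₀x₁· q
x₀x₁·-cong p≋q = prefix-cong x₀ (prefix-cong x₁ p≋q)

x₀x₁·-++ : ∀ p q → x₀x₁· (p ++ q) ≡ x₀x₁· p ++ x₀x₁· q
x₀x₁·-++ p q = trans (cong (prefix x₀) (prefix-++ x₁ p q)) (prefix-++ x₀ (prefix x₁ p) (prefix x₁ q))

x₀x₁·-scale : ∀ c p → x₀x₁· scale c p ≡ scale c (x₀x₁· p)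
x₀x₁·-scale c p = trans (cong (prefix x₀) (prefix-scale x₁ c p)) (prefix-scale x₀ c (prefix x₁ p))

x₀x₁·-Σ : ∀ L f → x₀x₁· Σ L f ≡ Σ L (x₀x₁·_ ∘ f)
x₀x₁·-Σ L f = trans (cong (prefix x₀) (map-concatMap _ f L)) (map-concatMap _ (prefix x₁ ∘ f) L)

zw-twos : ∀ m → zw (replicate m 2) ≡ x₀x₁^ m
zw-twos zero = refl
zw-twos (suc m) = cong (λ u → x₀ ∷ x₁ ∷ u) (zw-twos m)

Σ₂₃₂ : ℕ → Poly
Σ₂₃₂ n = Σ (upTo n) (λ i → ⟦ zw (replicate i 2 ++ (3 ∷ replicate (n ∸ 1 ∸ i) 2)) ⟧)

Σ₂₃₂-suc : ∀ m → Σ₂₃₂ (suc m) ≡ ⟦ x₀ ∷ x₀ ∷ x₁ ∷ x₀x₁^ m ⟧ ++ x₀x₁· Σ₂₃₂ m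
Σ₂₃₂-suc zero = refl
Σ₂₃₂-suc (suc m) = cong₂ _++_ (cong (λ u → ⟦ x₀ ∷ x₀ ∷ x₁ ∷ u ⟧) (zw-twos (suc m))) (begin
  Σ (applyUpTo suc (suc m)) term    ≡⟨ cong (λ L → Σ L term) (map-upTo suc (suc m)) ⟨
  Σ (map suc (upTo (suc m))) term   ≡⟨ concatMap-map term suc (upTo (suc m)) ⟩
  Σ (upTo (suc m)) (term ∘ suc)     ≡⟨ x₀x₁·-Σ (upTo (suc m)) (λ i → ⟦ zw (replicate i 2 ++ (3 ∷ replicate (m ∸ i) 2)) ⟧) ⟨
  x₀x₁· Σ₂₃₂ (suc m)                ∎)
  where
  open ≡-Reasoning
  term : ℕ → Poly
  term i = ⟦ zw (replicate i 2 ++ (3 ∷ replicate (suc m ∸ i) 2)) ⟧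

shuffle-x₀x₁^-x₀ : ∀ m → shw (x₀x₁^ m) (x₀ ∷ []) ≋ ⟦ x₀x₁^ m ++ x₀ ∷ [] ⟧ ++ scale two (Σ₂₃₂ m)
shuffle-x₀x₁^-x₀ zero = ≋-refl
shuffle-x₀x₁^-x₀ (suc m) = let open ≋-Reasoning in begin
  shw (x₀x₁^ suc m) (x₀ ∷ [])
    ≡⟨ cong (_++ ⟦ D ⟧) (prefix-++ x₀ (prefix x₁ (shw (x₀x₁^ m) (x₀ ∷ []))) ⟦ x₀ ∷ x₁ ∷ x₀x₁^ m ⟧) ⟩
  (x₀x₁· shw (x₀x₁^ m) (x₀ ∷ []) ++ ⟦ D ⟧) ++ ⟦ D ⟧
    ≈⟨ ++-cong (++-cong (x₀x₁·-cong (shuffle-x₀x₁^-x₀ m)) ≋-refl) ≋-refl ⟩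
  (x₀x₁· (⟦ x₀x₁^ m ++ x₀ ∷ [] ⟧ ++ scale two (Σ₂₃₂ m)) ++ ⟦ D ⟧) ++ ⟦ D ⟧
    ≡⟨ cong (λ p → (p ++ ⟦ D ⟧) ++ ⟦ D ⟧)
            (trans (x₀x₁·-++ ⟦ x₀x₁^ m ++ x₀ ∷ [] ⟧ (scale two (Σ₂₃₂ m))) (cong (⟦ x₀x₁^ suc m ++ x₀ ∷ [] ⟧ ++_) (x₀x₁·-scale two (Σ₂₃₂ m)))) ⟩
  ((⟦ x₀x₁^ suc m ++ x₀ ∷ [] ⟧ ++ scale two (x₀x₁· Σ₂₃₂ m)) ++ ⟦ D ⟧) ++ ⟦ D ⟧
    ≈⟨ doubled ⟦ x₀x₁^ suc m ++ x₀ ∷ [] ⟧ (x₀x₁· Σ₂₃₂ m) ⟦ D ⟧ ⟩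
  ⟦ x₀x₁^ suc m ++ x₀ ∷ [] ⟧ ++ scale two (⟦ D ⟧ ++ x₀x₁· Σ₂₃₂ m)
    ≡⟨ cong (λ p → ⟦ x₀x₁^ suc m ++ x₀ ∷ [] ⟧ ++ scale two p) (Σ₂₃₂-suc m) ⟨
  ⟦ x₀x₁^ suc m ++ x₀ ∷ [] ⟧ ++ scale two (Σ₂₃₂ (suc m)) ∎
  where
  D = x₀ ∷ x₀ ∷ x₁ ∷ x₀x₁^ m
  doubled : ∀ a t d → ((a ++ scale two t) ++ d) ++ d ≋ a ++ scale two (d ++ t)
  doubled a t d = coeffwise λ w → begin
    coeff (((a ++ scale two t) ++ d) ++ d) w
      ≡⟨ trans (coeff-++ ((a ++ scale two t) ++ d) d w) (cong (_+ℚ coeff d w) (trans (coeff-++ (a ++ scale two t) d w)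
           (cong (_+ℚ coeff d w) (trans (coeff-++ a (scale two t) w) (cong (coeff a w +ℚ_) (coeff-scale two t w)))))) ⟩
    ((coeff a w +ℚ two *ℚ coeff t w) +ℚ coeff d w) +ℚ coeff d w
      ≡⟨ solve 3 (λ a t d → ((a :+ con two :* t) :+ d) :+ d := a :+ con two :* (d :+ t))
               refl (coeff a w) (coeff t w) (coeff d w) ⟩
    coeff a w +ℚ two *ℚ (coeff d w +ℚ coeff t w)
      ≡⟨ sym (trans (coeff-++ a (scale two (d ++ t)) w) (cong (coeff a w +ℚ_) (trans (coeff-scale two (d ++ t) w)
           (cong (two *ℚ_) (coeff-++ d t w))))) ⟩
    coeff (a ++ scale two (d ++ t)) w ∎
    where open ≡-Reasoning

x₀x₁ⁿx₀≡ᶠ-Σ₂₃₂ : ∀ n → ⟦ x₀x₁^ n ++ x₀ ∷ [] ⟧ ≡ᶠ scale (- two) (Σ₂₃₂ n)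
x₀x₁ⁿx₀≡ᶠ-Σ₂₃₂ n = ≋-R shuffled (mul-R ⟦ x₀x₁^ n ⟧ gen-x₀)
  where
  open ≋-Reasoning
  shuffled : ⟦ x₀x₁^ n ⟧ ш ⟦ x₀ ∷ [] ⟧ ≋ ⟦ x₀x₁^ n ++ x₀ ∷ [] ⟧ ⊖ scale (- two) (Σ₂₃₂ n)
  shuffled = begin
    ⟦ x₀x₁^ n ⟧ ш ⟦ x₀ ∷ [] ⟧                            ≈⟨ ⟦⟧-ш-⟦⟧ (x₀x₁^ n) (x₀ ∷ []) ⟩
    shw (x₀x₁^ n) (x₀ ∷ [])                              ≈⟨ shuffle-x₀x₁^-x₀ n ⟩
    ⟦ x₀x₁^ n ++ x₀ ∷ [] ⟧ ++ scale two (Σ₂₃₂ n)          ≈⟨ ++-scale≋⊖-scale two _ (Σ₂₃₂ n) ⟩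
    ⟦ x₀x₁^ n ++ x₀ ∷ [] ⟧ ⊖ scale (- two) (Σ₂₃₂ n)       ∎

-- The stuffle y * y₂^m

ιP-++ : ∀ p q → ιP (p ++ q) ≡ ιP p ++ ιP q
ιP-++ p q = map-++ _ p q

ιP-prefix-1 : ∀ p → ιP (prefix 1 p) ≡ x₀x₁· ιP p
ιP-prefix-1 [] = refl
ιP-prefix-1 ((c , u) ∷ p) = cong ((c , x₀ ∷ x₁ ∷ ιw u) ∷_) (ιP-prefix-1 p)

ιw-ones : ∀ m → ιw (replicate m 1) ≡ x₀x₁^ m
ιw-ones zero = refl
ιw-ones (suc m) = cong (λ u → x₀ ∷ x₁ ∷ u) (ιw-ones m)

-- With y the letter of code k (the code k stands for y_(k+1), so 1 is y₂):
-- inserted k m = Σ_{a+b=m} y₂^a y y₂^b, and merged k m = Σ_{a+b=m-1} y₂^a (y ⋄ y₂) y₂^b,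
-- where y ⋄ y₂ = y_(k+3) has code suc (k + 1).
inserted : ℕ → ℕ → LC ℕ
inserted k zero = (1ℚ , k ∷ []) ∷ []
inserted k (suc m) = (1ℚ , k ∷ replicate (suc m) 1) ∷ prefix 1 (inserted k m)

merged : ℕ → ℕ → LC ℕ
merged k zero = []
merged k (suc m) = inserted (suc (k + 1)) m

inserted-merged : ∀ k m →
  inserted (suc (k + 1)) m ≡ (1ℚ , suc (k + 1) ∷ replicate m 1) ∷ prefix 1 (merged k m)
inserted-merged k zero = refl
inserted-merged k (suc m) = refl

stuffle-y₂^ : ∀ k m → ιP (stw (k ∷ []) (replicate m 1)) ≋ ιP (inserted k m ++ merged k m)
stuffle-y₂^ k zero = ≋-refl
stuffle-y₂^ k (suc m) = begin
  ιP (stw (k ∷ []) (replicate (suc m) 1))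
    ≡⟨ cong (e ∷_) (trans (ιP-++ (prefix 1 S) _) (cong (_++ ⟦ ιw (k₂ ∷ replicate m 1) ⟧) (ιP-prefix-1 S))) ⟩
  e ∷ (x₀x₁· ιP S ++ ⟦ ιw (k₂ ∷ replicate m 1) ⟧)
    ≈⟨ ∷-cong e (++-cong (x₀x₁·-cong (stuffle-y₂^ k m)) ≋-refl) ⟩
  e ∷ (x₀x₁· ιP (inserted k m ++ merged k m) ++ ⟦ ιw (k₂ ∷ replicate m 1) ⟧)
    ≡⟨ cong (λ p → e ∷ (p ++ ⟦ ιw (k₂ ∷ replicate m 1) ⟧))
            (trans (cong x₀x₁·_ (ιP-++ (inserted k m) (merged k m))) (x₀x₁·-++ (ιP (inserted k m)) (ιP (merged k m)))) ⟩
  e ∷ ((x₀x₁· ιP (inserted k m) ++ x₀x₁· ιP (merged k m)) ++ ⟦ ιw (k₂ ∷ replicate m 1) ⟧)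
    ≡⟨ cong (e ∷_) (++-assoc (x₀x₁· ιP (inserted k m)) _ _) ⟩
  e ∷ (x₀x₁· ιP (inserted k m) ++ (x₀x₁· ιP (merged k m) ++ ⟦ ιw (k₂ ∷ replicate m 1) ⟧))
    ≈⟨ ∷-cong e (++-congˡ (x₀x₁· ιP (inserted k m)) (++-comm (x₀x₁· ιP (merged k m)) _)) ⟩
  e ∷ (x₀x₁· ιP (inserted k m) ++ (⟦ ιw (k₂ ∷ replicate m 1) ⟧ ++ x₀x₁· ιP (merged k m)))
    ≡⟨ cong (λ p → e ∷ (x₀x₁· ιP (inserted k m) ++ p))
            (trans (cong ιP (inserted-merged k m)) (cong ((1ℚ , ιw (k₂ ∷ replicate m 1)) ∷_) (ιP-prefix-1 (merged k m)))) ⟨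
  e ∷ (x₀x₁· ιP (inserted k m) ++ ιP (inserted k₂ m))
    ≡⟨ cong (e ∷_) (trans (ιP-++ (prefix 1 (inserted k m)) _) (cong (_++ ιP (inserted k₂ m)) (ιP-prefix-1 (inserted k m)))) ⟨
  ιP (inserted k (suc m) ++ merged k (suc m)) ∎
  where
  open ≋-Reasoning
  k₂ = suc (k + 1)
  S = stw (k ∷ []) (replicate m 1)
  e = (1ℚ , ιw (k ∷ replicate (suc m) 1))

Σ₂₃₂≋merged : ∀ n → Σ₂₃₂ n ≋ ιP (merged 0 n)
Σ₂₃₂≋merged zero = ≋-refl
Σ₂₃₂≋merged (suc m) = begin
  Σ₂₃₂ (suc m)                                              ≡⟨ Σ₂₃₂-suc m ⟩
  ⟦ x₀ ∷ x₀ ∷ x₁ ∷ x₀x₁^ m ⟧ ++ x₀x₁· Σ₂₃₂ m               ≈⟨ ∷-cong _ (x₀x₁·-cong (Σ₂₃₂≋merged m)) ⟩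
  ⟦ x₀ ∷ x₀ ∷ x₁ ∷ x₀x₁^ m ⟧ ++ x₀x₁· ιP (merged 0 m)      ≡⟨ cong₂ (λ u p → ⟦ x₀ ∷ x₀ ∷ x₁ ∷ u ⟧ ++ p)
                                                                     (ιw-ones m) (ιP-prefix-1 (merged 0 m)) ⟨
  ιP ((1ℚ , 2 ∷ replicate m 1) ∷ prefix 1 (merged 0 m))     ≡⟨ cong ιP (inserted-merged 0 m) ⟨
  ιP (merged 0 (suc m))                                     ∎
  where open ≋-Reasoning

-- Alternating sums of double shuffle relations

oddLetter : ℕ → ℕ
oddLetter i = 2 * i + 1 ∸ 1

oddLetter-suc : ∀ i → suc (oddLetter i + 1) ≡ oddLetter (suc i)
oddLetter-suc i = begin
  suc (oddLetter i + 1)  ≡⟨ cong (λ k → suc (k + 1)) (m+n∸n≡m (2 * i) 1) ⟩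
  suc (2 * i + 1)        ≡⟨ cong suc (+-comm (2 * i) 1) ⟩
  2 + 2 * i              ≡⟨ *-suc 2 i ⟨
  2 * suc i              ≡⟨ m+n∸n≡m (2 * suc i) 1 ⟨
  oddLetter (suc i)      ∎
  where open ≡-Reasoning

oddLetter-suc-∈𝔥⁰ : ∀ i → InH0 (oddLetter (suc i) ∷ [])
oddLetter-suc-∈𝔥⁰ i = subst (λ k → InH0 (k ∷ [])) (sym (m+n∸n≡m (2 * suc i) 1)) tt

alternating-stuffles : ∀ n →
  Σ (upTo n) (λ j → scale (sgn (suc j)) (ιP (stw (oddLetter (suc j) ∷ []) (map (λ k → k ∸ 1) (replicate (n ∸ suc j) 2)))))
    ≋ scale (- 1ℚ) (Σ₂₃₂ n)
alternating-stuffles n = begin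
  Σ (upTo n) (λ j → scale (sgn (suc j)) (ιP (stw (oddLetter (suc j) ∷ []) (map (λ k → k ∸ 1) (replicate (n ∸ suc j) 2)))))
    ≈⟨ Σ-cong (applyUpTo⁺₁ id n λ {j} j<n → scale-cong (sgn (suc j)) (split j<n)) ⟩
  Σ (upTo n) (λ j → scale (sgn (suc j)) (c j ++ c (suc j)))
    ≈⟨ alternating-telescope c n ⟩
  scale (sgn n) (c n) ⊖ c 0
    ≡⟨ cong (λ m → scale (sgn n) (ιP (merged (oddLetter n) m)) ⊖ c 0) (n∸n≡0 n) ⟩
  scale (- 1ℚ) (c 0)
    ≈⟨ scale-cong (- 1ℚ) (≋-sym (Σ₂₃₂≋merged n)) ⟩
  scale (- 1ℚ) (Σ₂₃₂ n) ∎
  where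
  open ≋-Reasoning
  c : ℕ → Poly
  c j = ιP (merged (oddLetter j) (n ∸ j))
  split : ∀ {j} → j < n → ιP (stw (oddLetter (suc j) ∷ []) (map (λ k → k ∸ 1) (replicate (n ∸ suc j) 2))) ≋ c j ++ c (suc j)
  split {j} j<n = begin
    ιP (stw (oddLetter (suc j) ∷ []) (map (λ k → k ∸ 1) (replicate (n ∸ suc j) 2)))
      ≡⟨ cong (λ v → ιP (stw (oddLetter (suc j) ∷ []) v)) (map-replicate (λ k → k ∸ 1) (n ∸ suc j) 2) ⟩
    ιP (stw (oddLetter (suc j) ∷ []) (replicate (n ∸ suc j) 1))
      ≈⟨ stuffle-y₂^ (oddLetter (suc j)) (n ∸ suc j) ⟩
    ιP (inserted (oddLetter (suc j)) (n ∸ suc j) ++ merged (oddLetter (suc j)) (n ∸ suc j))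
      ≡⟨ ιP-++ (inserted (oddLetter (suc j)) (n ∸ suc j)) _ ⟩
    ιP (inserted (oddLetter (suc j)) (n ∸ suc j)) ++ c (suc j)
      ≡⟨ cong (λ p → ιP p ++ c (suc j)) inserted≡merged ⟨
    c j ++ c (suc j) ∎
    where
    inserted≡merged : merged (oddLetter j) (n ∸ j) ≡ inserted (oddLetter (suc j)) (n ∸ suc j)
    inserted≡merged = trans (cong (merged (oddLetter j)) (+-∸-assoc 1 j<n))
                            (cong (λ k → inserted k (n ∸ suc j)) (oddLetter-suc j))

scale-two-swap : ∀ P T → scale (- two) (P ⊖ scale (- 1ℚ) T) ≋ scale (- two) T ⊖ scale two P
scale-two-swap P T = coeffwise λ w → begin
  coeff (scale (- two) (P ⊖ scale (- 1ℚ) T)) w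
    ≡⟨ trans (coeff-scale (- two) (P ⊖ scale (- 1ℚ) T) w)
             (cong (- two *ℚ_) (trans (coeff-⊖ P (scale (- 1ℚ) T) w)
                                      (cong (λ x → coeff P w +ℚ - 1ℚ *ℚ x) (coeff-scale (- 1ℚ) T w)))) ⟩
  - two *ℚ (coeff P w +ℚ - 1ℚ *ℚ (- 1ℚ *ℚ coeff T w))
    ≡⟨ solve 2 (λ p t → con (- two) :* (p :+ con (- 1ℚ) :* (con (- 1ℚ) :* t))
                      := con (- two) :* t :+ con (- 1ℚ) :* (con two :* p)) refl (coeff P w) (coeff T w) ⟩
  - two *ℚ coeff T w +ℚ - 1ℚ *ℚ (two *ℚ coeff P w)
    ≡⟨ trans (coeff-⊖ (scale (- two) T) (scale two P) w)
             (cong₂ (λ x y → x +ℚ - 1ℚ *ℚ y) (coeff-scale (- two) T w) (coeff-scale two P w)) ⟨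
  coeff (scale (- two) T ⊖ scale two P) w ∎
  where open ≡-Reasoning

Σ₂₃₂≡ᶠ-alternating : ∀ n →
  scale (- two) (Σ₂₃₂ n)
    ≡ᶠ scale two (Σ (map suc (upTo n)) (λ i → scale (sgn i) (⟦ zw ((2 * i + 1) ∷ []) ⟧ ш ⟦ zw (replicate (n ∸ i) 2) ⟧)))
Σ₂₃₂≡ᶠ-alternating n =
  ≋-R combination≋ (scale-R (- two) (Σ-R (λ j → scale-R (sgn (suc j)) (gen-ds (u j) (v j) (oddLetter-suc-∈𝔥⁰ j))) (upTo n)))
  where
  u v : ℕ → YWord
  u j = oddLetter (suc j) ∷ []
  v j = map (λ k → k ∸ 1) (replicate (n ∸ suc j) 2)
  shuffles stuffles products : ℕ → Poly
  shuffles j = shw (ιw (u j)) (ιw (v j))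
  stuffles j = ιP (stw (u j) (v j))
  products i = ⟦ zw ((2 * i + 1) ∷ []) ⟧ ш ⟦ zw (replicate (n ∸ i) 2) ⟧
  s : ℕ → ℚ
  s j = sgn (suc j)

  combination≋ : scale (- two) (Σ (upTo n) (λ j → scale (s j) (shuffles j ⊖ stuffles j)))
                   ≋ scale (- two) (Σ₂₃₂ n) ⊖ scale two (Σ (map suc (upTo n)) (λ i → scale (sgn i) (products i)))
  combination≋ = begin
    scale (- two) (Σ (upTo n) (λ j → scale (s j) (shuffles j ⊖ stuffles j)))
      ≈⟨ scale-cong (- two) (Σ-scale-⊖ s shuffles stuffles (upTo n)) ⟩
    scale (- two) (Σ (upTo n) (λ j → scale (s j) (shuffles j)) ⊖ Σ (upTo n) (λ j → scale (s j) (stuffles j)))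
      ≈⟨ scale-cong (- two) (⊖-cong (Σ-cong (universal (λ j → scale-cong (s j) (≋-sym (⟦⟧-ш-⟦⟧ (ιw (u j)) (ιw (v j))))) (upTo n)))
                                     (alternating-stuffles n)) ⟩
    scale (- two) (Σ (upTo n) (λ j → scale (s j) (products (suc j))) ⊖ scale (- 1ℚ) (Σ₂₃₂ n))
      ≈⟨ scale-two-swap (Σ (upTo n) (λ j → scale (s j) (products (suc j)))) (Σ₂₃₂ n) ⟩
    scale (- two) (Σ₂₃₂ n) ⊖ scale two (Σ (upTo n) (λ j → scale (s j) (products (suc j))))
      ≡⟨ cong (λ p → scale (- two) (Σ₂₃₂ n) ⊖ scale two p) (concatMap-map (λ i → scale (sgn i) (products i)) suc (upTo n)) ⟨
    scale (- two) (Σ₂₃₂ n) ⊖ scale two (Σ (map suc (upTo n)) (λ i → scale (sgn i) (products i))) ∎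
    where open ≋-Reasoning

-- The identities hold for n = 0 as well.
proposition5p22 : (n : ℕ) → 1 ≤ n →
    (⟦ concat (replicate n (x₀ ∷ x₁ ∷ [])) ++ (x₀ ∷ []) ⟧
      ≡ᶠ scale (- two) (Σ (upTo n) (λ i → ⟦ zw (replicate i 2 ++ (3 ∷ replicate (n ∸ 1 ∸ i) 2)) ⟧)))
    × (scale (- two) (Σ (upTo n) (λ i → ⟦ zw (replicate i 2 ++ (3 ∷ replicate (n ∸ 1 ∸ i) 2)) ⟧))
      ≡ᶠ scale two (Σ (map suc (upTo n)) (λ i → scale (sgn i) (⟦ zw ((2 * i + 1) ∷ []) ⟧ ш ⟦ zw (replicate (n ∸ i) 2) ⟧))))
proposition5p22 n _ = x₀x₁ⁿx₀≡ᶠ-Σ₂₃₂ n , Σ₂₃₂≡ᶠ-alternating n
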